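{- Let $n$ be even and consider $\gamma_{2k}:\mathbb{F}_2^n\to\mathbb{F}_2^n$. If $k\geq n/2$, then $$\gamma_{2k}=S^{2k \bmod n}\odot(\mathbbm{1}+S^{n-1})\odot(\mathbbm{1}+S^{n-3})\odot\cdots\odot(\mathbbm{1}+S).$$ In particular: (a) if $k,k'\geq n/2$ and $2k\equiv 2k' \pmod n$, then $\gamma_{2k}=\gamma_{2k'}$; (b) if $2k\geq n$, then $\gamma_{2k}=\gamma_{2(\frac n2 + (k \bmod \frac n2))}$.
   Context: Let $\mathbbm{1}=(1,\dots,1)\in\mathbb{F}_2^n$, let $\odot$ denote component-wise multiplication of vectors in $\mathbb{F}_2^n$, and let $S:\mathbb{F}_2^n\to\mathbb{F}_2^n$ be the cyclic left shift $S(x_1,\dots,x_n)=(x_2,\dots,x_n,x_1)$. Functions are combined pointwise: e.g. $(f\odot(\mathbbm{1}+g))(x)=f(x)\odot(\mathbbm{1}+g(x))$. Define $\gamma_0=\mathrm{id}$ and, for $k\geq1$, $\gamma_{2k}=S^{2k}\odot(\mathbbm{1}+S^{2k-1})\odot(\mathbbm{1}+S^{2k-3})\odot\cdots\odot(\mathbbm{1}+S)$, i.e. $\gamma_{2k}(x)=S^{2k}(x)\odot(\mathbbm{1}+S^{2k-1}(x))\odot\cdots\odot(\mathbbm{1}+S(x))$. -}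

module Defs where

open import Data.Bool using (Bool; true; false; _∧_; _xor_; not)
open import Data.Nat using (ℕ; zero; suc; _+_; _*_)
open import Data.Vec using (Vec; []; _∷_; _∷ʳ_; zipWith; map; replicate)

-- Elements of 𝔽₂ⁿ are modelled as Vec Bool n (true = 1, false = 0;
-- addition in 𝔽₂ is xor, multiplication is ∧).
𝔽₂^ : ℕ → Set
𝔽₂^ n = Vec Bool n

_⊙_ : ∀ {n} → 𝔽₂^ n → 𝔽₂^ n → 𝔽₂^ n
_⊙_ = zipWith _∧_

𝟙 : ∀ {n} → 𝔽₂^ n
𝟙 {n} = replicate n true

𝟙+_ : ∀ {n} → 𝔽₂^ n → 𝔽₂^ n
𝟙+ x = zipWith _xor_ 𝟙 x

S : ∀ {n} → 𝔽₂^ n → 𝔽₂^ n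
S []       = []
S (x ∷ xs) = xs ∷ʳ x

S^ : ∀ {n} → ℕ → 𝔽₂^ n → 𝔽₂^ n
S^ zero    x = x
S^ (suc j) x = S (S^ j x)

oddProd : ∀ {n} → ℕ → 𝔽₂^ n → 𝔽₂^ n
oddProd zero    x = 𝟙
oddProd (suc k) x = (𝟙+ S^ (suc (2 * k)) x) ⊙ oddProd k x

-- γ k stands for γ_{2k}:  γ₀ = id,  γ_{2k} = S^{2k} ⊙ (𝟙+S^{2k-1}) ⊙ ⋯ ⊙ (𝟙+S)  for k ≥ 1
γ : ∀ {n} → ℕ → 𝔽₂^ n → 𝔽₂^ n
γ zero    x = x
γ (suc k) x = S^ (2 * suc k) x ⊙ oddProd (suc k) x

{-# OPTIONS --safe #-}
-- Since n = 2m, the shift S^(2j+1) depends only on j mod m, so every factor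
-- 𝟙 + S^(2j+1) with j ≥ m repeats one with j < m; ⊙ is idempotent,
-- associative and commutative, so repeated factors are absorbed and the odd
-- product stabilises at k = m.  The leading factor S^(2k) only depends on
-- 2k mod n because S^n = id.  Parts (a) and (b) are then comparisons of
-- residues.
module Submission where

open import Defs
open import Data.Bool using (Bool)
open import Data.Bool.Properties using (∧-assoc; ∧-comm; ∧-idem; ∧-identityʳ)
open import Data.List as List using (List; []; _∷_; _++_; [_])
open import Data.List.Properties using (++-assoc; ++-identityʳ)
open import Data.Nat using (ℕ; zero; suc; _+_; _*_; _≤_; _<_; _≤′_; ≤′-refl; ≤′-step; NonZero)
open import Data.Nat.DivMod
  using (_%_; _/_; m≡m%n+[m/n]*n; [m+kn]%n≡m%n; [m+n]%n≡m%n; m%n%n≡m%n; m%n<n; m<n⇒m%n≡m)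
open import Data.Nat.Properties using (+-comm; m≤m+n; *-monoʳ-<; *-cancelˡ-≤; m<1+n⇒m<n∨m≡n; ≤⇒≤′)
open import Data.Nat.Solver using (module +-*-Solver)
open import Data.Product using (_×_; _,_)
open import Data.Sum using (inj₁; inj₂)
open import Data.Vec as Vec using (_∷_; toList)
open import Data.Vec.Properties
  using (toList-injective; toList-∷ʳ; length-toList; zipWith-assoc; zipWith-comm; zipWith-idem; zipWith-identityʳ)
open import Data.Vec.Relation.Binary.Equality.Cast using (cast-is-id)
open import Relation.Binary.PropositionalEquality using (_≡_; refl; sym; trans; cong; cong₂; module ≡-Reasoning)
open ≡-Reasoning

-- S^n x ≡ x is proved on lists: on vectors the rotation argument would need
-- casts between Vec (a + b) and Vec (b + a).
rotate : List Bool → List Bool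
rotate []       = []
rotate (x ∷ xs) = xs ++ [ x ]

rotate^ : ℕ → List Bool → List Bool
rotate^ zero    xs = xs
rotate^ (suc j) xs = rotate (rotate^ j xs)

rotate^-suc : ∀ j xs → rotate^ (suc j) xs ≡ rotate^ j (rotate xs)
rotate^-suc zero    xs = refl
rotate^-suc (suc j) xs = cong rotate (rotate^-suc j xs)

rotate^-++ : ∀ xs ys → rotate^ (List.length xs) (xs ++ ys) ≡ ys ++ xs
rotate^-++ []       ys = sym (++-identityʳ ys)
rotate^-++ (x ∷ xs) ys = begin
  rotate^ (suc (List.length xs)) (x ∷ xs ++ ys)   ≡⟨ rotate^-suc (List.length xs) _ ⟩
  rotate^ (List.length xs) ((xs ++ ys) ++ [ x ])  ≡⟨ cong (rotate^ (List.length xs)) (++-assoc xs ys _) ⟩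
  rotate^ (List.length xs) (xs ++ ys ++ [ x ])    ≡⟨ rotate^-++ xs _ ⟩
  (ys ++ [ x ]) ++ xs                             ≡⟨ ++-assoc ys _ xs ⟩
  ys ++ x ∷ xs                                    ∎

rotate^-length : ∀ xs → rotate^ (List.length xs) xs ≡ xs
rotate^-length xs = begin
  rotate^ (List.length xs) xs         ≡⟨ cong (rotate^ (List.length xs)) (++-identityʳ xs) ⟨
  rotate^ (List.length xs) (xs ++ []) ≡⟨ rotate^-++ xs [] ⟩
  xs                                  ∎

toList-S : ∀ {n} (x : 𝔽₂^ n) → toList (S x) ≡ rotate (toList x)
toList-S Vec.[]   = refl
toList-S (x ∷ xs) = toList-∷ʳ x xs

toList-S^ : ∀ {n} j (x : 𝔽₂^ n) → toList (S^ j x) ≡ rotate^ j (toList x)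
toList-S^ zero    x = refl
toList-S^ (suc j) x = trans (toList-S (S^ j x)) (cong rotate (toList-S^ j x))

S^-length : ∀ {n} (x : 𝔽₂^ n) → S^ n x ≡ x
S^-length {n} x = trans (sym (cast-is-id refl (S^ n x))) (toList-injective refl (S^ n x) x (begin
  toList (S^ n x)                             ≡⟨ toList-S^ n x ⟩
  rotate^ n (toList x)                        ≡⟨ cong (λ j → rotate^ j (toList x)) (length-toList x) ⟨
  rotate^ (List.length (toList x)) (toList x) ≡⟨ rotate^-length (toList x) ⟩
  toList x                                    ∎))

S^-+ : ∀ {n} i j (x : 𝔽₂^ n) → S^ (i + j) x ≡ S^ i (S^ j x)
S^-+ zero    j x = refl
S^-+ (suc i) j x = cong S (S^-+ i j x)

S^-*-length : ∀ {n} q (x : 𝔽₂^ n) → S^ (q * n) x ≡ x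
S^-*-length zero        x = refl
S^-*-length {n} (suc q) x = begin
  S^ (n + q * n) x    ≡⟨ S^-+ n (q * n) x ⟩
  S^ n (S^ (q * n) x) ≡⟨ cong (S^ n) (S^-*-length q x) ⟩
  S^ n x              ≡⟨ S^-length x ⟩
  x                   ∎

S^-periodic : ∀ {n} j q (x : 𝔽₂^ n) → S^ (j + q * n) x ≡ S^ j x
S^-periodic j q x = trans (S^-+ j _ x) (cong (S^ j) (S^-*-length q x))

S^-% : ∀ {n} .{{_ : NonZero n}} j (x : 𝔽₂^ n) → S^ j x ≡ S^ (j % n) x
S^-% {n} j x = trans (cong (λ i → S^ i x) (m≡m%n+[m/n]*n j n)) (S^-periodic (j % n) (j / n) x)

⊙-identityʳ : ∀ {n} (a : 𝔽₂^ n) → a ⊙ 𝟙 ≡ a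
⊙-identityʳ = zipWith-identityʳ ∧-identityʳ

a⊙[a⊙p]≡a⊙p : ∀ {n} (a p : 𝔽₂^ n) → a ⊙ (a ⊙ p) ≡ a ⊙ p
a⊙[a⊙p]≡a⊙p a p = begin
  a ⊙ (a ⊙ p) ≡⟨ zipWith-assoc ∧-assoc a a p ⟨
  (a ⊙ a) ⊙ p ≡⟨ cong (_⊙ p) (zipWith-idem ∧-idem a) ⟩
  a ⊙ p       ∎

a⊙[b⊙p]≡b⊙[a⊙p] : ∀ {n} (a b p : 𝔽₂^ n) → a ⊙ (b ⊙ p) ≡ b ⊙ (a ⊙ p)
a⊙[b⊙p]≡b⊙[a⊙p] a b p = begin
  a ⊙ (b ⊙ p) ≡⟨ zipWith-assoc ∧-assoc a b p ⟨
  (a ⊙ b) ⊙ p ≡⟨ cong (_⊙ p) (zipWith-comm ∧-comm a b) ⟩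
  (b ⊙ a) ⊙ p ≡⟨ zipWith-assoc ∧-assoc b a p ⟩
  b ⊙ (a ⊙ p) ∎

oddFactor : ∀ {n} → ℕ → 𝔽₂^ n → 𝔽₂^ n
oddFactor j x = 𝟙+ S^ (suc (2 * j)) x

oddFactor-absorbed : ∀ {n} {j k} (x : 𝔽₂^ n) → j < k → oddFactor j x ⊙ oddProd k x ≡ oddProd k x
oddFactor-absorbed {j = j} {suc k} x j<1+k with m<1+n⇒m<n∨m≡n j<1+k
... | inj₂ refl = a⊙[a⊙p]≡a⊙p (oddFactor j x) (oddProd j x)
... | inj₁ j<k  = trans (a⊙[b⊙p]≡b⊙[a⊙p] (oddFactor j x) (oddFactor k x) (oddProd k x))
                        (cong (oddFactor k x ⊙_) (oddFactor-absorbed x j<k))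

γ≡S^⊙oddProd : ∀ {n} k (x : 𝔽₂^ n) → γ k x ≡ S^ (2 * k) x ⊙ oddProd k x
γ≡S^⊙oddProd zero    x = sym (⊙-identityʳ x)
γ≡S^⊙oddProd (suc k) x = refl

[m*n]%[m*o]≡m*[n%o] : ∀ m n o .{{_ : NonZero m}} .{{_ : NonZero o}} .{{_ : NonZero (m * o)}} →
                      (m * n) % (m * o) ≡ m * (n % o)
[m*n]%[m*o]≡m*[n%o] m n o = begin
  (m * n) % (m * o)                           ≡⟨ cong (λ i → (m * i) % (m * o)) (m≡m%n+[m/n]*n n o) ⟩
  (m * (n % o + (n / o) * o)) % (m * o)       ≡⟨ cong (_% (m * o)) (distribute m (n % o) (n / o) o) ⟩
  (m * (n % o) + (n / o) * (m * o)) % (m * o) ≡⟨ [m+kn]%n≡m%n (m * (n % o)) (n / o) (m * o) ⟩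
  (m * (n % o)) % (m * o)                     ≡⟨ m<n⇒m%n≡m (*-monoʳ-< m (m%n<n n o)) ⟩
  m * (n % o)                                 ∎
  where
  open +-*-Solver
  distribute : ∀ c r q d → c * (r + q * d) ≡ c * r + q * (c * d)
  distribute = solve 4 (λ c r q d → c :* (r :+ q :* d) := c :* r :+ q :* (c :* d)) refl

module _ (m : ℕ) .{{_ : NonZero m}} where

  oddFactor-% : ∀ j (x : 𝔽₂^ (2 * m)) → oddFactor j x ≡ oddFactor (j % m) x
  oddFactor-% j x = cong 𝟙+_ (begin
    S^ (suc (2 * j)) x                           ≡⟨ cong (λ i → S^ (suc (2 * i)) x) (m≡m%n+[m/n]*n j m) ⟩
    S^ (suc (2 * (j % m + (j / m) * m))) x       ≡⟨ cong (λ i → S^ i x) (regroup (j % m) (j / m)) ⟩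
    S^ (suc (2 * (j % m)) + (j / m) * (2 * m)) x ≡⟨ S^-periodic (suc (2 * (j % m))) (j / m) x ⟩
    S^ (suc (2 * (j % m))) x                     ∎)
    where
    open +-*-Solver
    regroup : ∀ r q → suc (2 * (r + q * m)) ≡ suc (2 * r) + q * (2 * m)
    regroup r q = solve 3 (λ r q m → con 1 :+ con 2 :* (r :+ q :* m) := con 1 :+ con 2 :* r :+ q :* (con 2 :* m)) refl r q m

  oddProd-absorbs : ∀ j (x : 𝔽₂^ (2 * m)) → oddFactor j x ⊙ oddProd m x ≡ oddProd m x
  oddProd-absorbs j x = trans (cong (_⊙ oddProd m x) (oddFactor-% j x)) (oddFactor-absorbed x (m%n<n j m))

  oddProd-stable : ∀ {k} → m ≤′ k → (x : 𝔽₂^ (2 * m)) → oddProd k x ≡ oddProd m x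
  oddProd-stable ≤′-refl x = refl
  oddProd-stable (≤′-step {k} m≤k) x = begin
    oddFactor k x ⊙ oddProd k x ≡⟨ cong (oddFactor k x ⊙_) (oddProd-stable m≤k x) ⟩
    oddFactor k x ⊙ oddProd m x ≡⟨ oddProd-absorbs k x ⟩
    oddProd m x                 ∎

lemma2 : (m : ℕ) → .{{_ : NonZero m}} → .{{_ : NonZero (2 * m)}} →
         ((k : ℕ) → m ≤ k → (x : 𝔽₂^ (2 * m)) →
            γ k x ≡ (S^ ((2 * k) % (2 * m)) x ⊙ oddProd m x))
         × ((k k′ : ℕ) → m ≤ k → m ≤ k′ → (2 * k) % (2 * m) ≡ (2 * k′) % (2 * m) →
            (x : 𝔽₂^ (2 * m)) → γ k x ≡ γ k′ x)
         × ((k : ℕ) → 2 * m ≤ 2 * k → (x : 𝔽₂^ (2 * m)) →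
            γ k x ≡ γ (m + k % m) x)
lemma2 m = closedForm , sameResidue , reduce
  where
  closedForm : (k : ℕ) → m ≤ k → (x : 𝔽₂^ (2 * m)) → γ k x ≡ S^ ((2 * k) % (2 * m)) x ⊙ oddProd m x
  closedForm k m≤k x = trans (γ≡S^⊙oddProd k x) (cong₂ _⊙_ (S^-% (2 * k) x) (oddProd-stable m (≤⇒≤′ m≤k) x))

  sameResidue : (k k′ : ℕ) → m ≤ k → m ≤ k′ → (2 * k) % (2 * m) ≡ (2 * k′) % (2 * m) →
                (x : 𝔽₂^ (2 * m)) → γ k x ≡ γ k′ x
  sameResidue k k′ m≤k m≤k′ eq x =
    trans (closedForm k m≤k x) (trans (cong (λ i → S^ i x ⊙ oddProd m x) eq) (sym (closedForm k′ m≤k′ x)))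

  reduce : (k : ℕ) → 2 * m ≤ 2 * k → (x : 𝔽₂^ (2 * m)) → γ k x ≡ γ (m + k % m) x
  reduce k 2m≤2k = sameResidue k (m + k % m) (*-cancelˡ-≤ 2 2m≤2k) (m≤m+n m _) (begin
    (2 * k) % (2 * m)           ≡⟨ [m*n]%[m*o]≡m*[n%o] 2 k m ⟩
    2 * (k % m)                 ≡⟨ cong (2 *_) (m%n%n≡m%n k m) ⟨
    2 * (k % m % m)             ≡⟨ cong (2 *_) ([m+n]%n≡m%n (k % m) m) ⟨
    2 * ((k % m + m) % m)       ≡⟨ cong (λ i → 2 * (i % m)) (+-comm (k % m) m) ⟩
    2 * ((m + k % m) % m)       ≡⟨ [m*n]%[m*o]≡m*[n%o] 2 (m + k % m) m ⟨
    (2 * (m + k % m)) % (2 * m) ∎)
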